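{- Let $k \geq 3$ be an integer and let $n$ be a nonzero integer. Let $a,b,c,d$ be positive integers such that $a<b$, $c<d$, and $ac\geq 2|n|$. Suppose further that $ac+n$, $bc+n$, $ad+n$, $bd+n$ are $k$-th powers of positive integers. Then $bd \geq k^{k} (ac)^{k-1}/(4^{k-1}|n|^k)$. -}

module Defs where

open import Data.Nat using (ℕ; _<_; _^_)
open import Data.Integer using (ℤ; +_)
open import Data.Product using (∃-syntax; _×_)
open import Relation.Binary.PropositionalEquality using (_≡_)

IsPosKthPower : ℕ → ℤ → Set
IsPosKthPower k m = ∃[ x ] (0 < x × m ≡ + (x ^ k))

module Submission where

-- Write ac + n, bc + n, ad + n, bd + n as xᵏ, yᵏ, zᵏ, wᵏ. The identity
-- (ac + n)(bd + n) - (bc + n)(ad + n) = n(b - a)(d - c) shows that P = xw and Q = yz have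
-- k-th powers differing by D = |n|(b - a)(d - c), where 0 < D ≤ |n|bd. As ac ≥ 2|n|, each
-- shifted product is at least half the unshifted one, so Pᵏ, Qᵏ ≥ ac·bd/4. If P < Q, the
-- binomial theorem gives D = Qᵏ - Pᵏ ≥ kPᵏ⁻¹; raising kPᵏ⁻¹ ≤ |n|bd to the k-th power and
-- using (Pᵏ)ᵏ⁻¹ ≥ (ac·bd/4)ᵏ⁻¹ yields kᵏ(ac)ᵏ⁻¹(bd)ᵏ⁻¹ ≤ 4ᵏ⁻¹|n|ᵏ(bd)ᵏ; cancel (bd)ᵏ⁻¹.

open import Defs

module ℕ-Powers where
  open import Data.Nat
  open import Data.Nat.Properties
  open import Data.Nat.Tactic.RingSolver using (solve-∀)
  open import Data.Sum using (_⊎_; inj₁; inj₂)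
  open import Relation.Binary.PropositionalEquality
  open import Relation.Nullary using (yes; no)
  open import Relation.Nullary.Negation using (contradiction)

  ^-distribʳ-* : ∀ m n k → (m * n) ^ k ≡ m ^ k * n ^ k
  ^-distribʳ-* m n zero    = refl
  ^-distribʳ-* m n (suc k) = begin
    m * n * (m * n) ^ k      ≡⟨ cong (m * n *_) (^-distribʳ-* m n k) ⟩
    m * n * (m ^ k * n ^ k)  ≡⟨ interchange m n (m ^ k) (n ^ k) ⟩
    m * m ^ k * (n * n ^ k)  ∎
    where
    open ≡-Reasoning
    interchange : ∀ m n x y → m * n * (x * y) ≡ m * x * (n * y)
    interchange = solve-∀

  binomial-lowerBound : ∀ P j → P ^ suc j + suc j * P ^ j ≤ suc P ^ suc j
  binomial-lowerBound P zero    = ≤-reflexive (+-comm (P * 1) 1)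
  binomial-lowerBound P (suc j) = begin
    P ^ suc (suc j) + suc (suc j) * P ^ suc j                   ≤⟨ m≤m+n _ (suc j * P ^ j) ⟩
    P ^ suc (suc j) + suc (suc j) * P ^ suc j + suc j * P ^ j   ≡⟨ factor P j (P ^ j) ⟩
    suc P * (P ^ suc j + suc j * P ^ j)                         ≤⟨ *-monoʳ-≤ (suc P) (binomial-lowerBound P j) ⟩
    suc P * suc P ^ suc j                                       ∎
    where
    open ≤-Reasoning
    factor : ∀ P j X → P * (P * X) + (2 + j) * (P * X) + (1 + j) * X ≡ (1 + P) * (P * X + (1 + j) * X)
    factor = solve-∀

  ^-gap-lowerBound : ∀ j {P Q D} → P ^ suc j + D ≡ Q ^ suc j → 0 < D → suc j * P ^ j ≤ D
  ^-gap-lowerBound j {P} {Q} {D} Pᵏ+D≡Qᵏ 0<D with Q ≤? P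
  ... | yes Q≤P = contradiction (^-monoˡ-≤ (suc j) Q≤P) (<⇒≱ (subst (P ^ suc j <_) Pᵏ+D≡Qᵏ (m<m+n _ 0<D)))
  ... | no Q≰P  = +-cancelˡ-≤ (P ^ suc j) _ _ (begin
    P ^ suc j + suc j * P ^ j  ≤⟨ binomial-lowerBound P j ⟩
    suc P ^ suc j              ≤⟨ ^-monoˡ-≤ (suc j) (≰⇒> Q≰P) ⟩
    Q ^ suc j                  ≡⟨ Pᵏ+D≡Qᵏ ⟨
    P ^ suc j + D              ∎)
    where open ≤-Reasoning

  m+n≡o⇒2n≤o⇒o≤2m : ∀ {m n o} → m + n ≡ o → 2 * n ≤ o → o ≤ 2 * m
  m+n≡o⇒2n≤o⇒o≤2m {m} {n} {o} refl 2n≤o = +-cancelʳ-≤ (2 * n) o (2 * m) (begin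
    o + 2 * n            ≤⟨ +-monoʳ-≤ o 2n≤o ⟩
    (m + n) + (m + n)    ≡⟨ regroup m n ⟩
    2 * m + 2 * n        ∎)
    where
    open ≤-Reasoning
    regroup : ∀ m n → (m + n) + (m + n) ≡ 2 * m + 2 * n
    regroup = solve-∀

  bound-from-gap : ∀ j N A B P → 0 < B → suc j * P ^ j ≤ N * B → A * B ≤ 4 * P ^ suc j →
                   suc j ^ suc j * A ^ j ≤ B * (4 ^ j * N ^ suc j)
  bound-from-gap j N A B P 0<B kPʲ≤NB AB≤4Pᵏ =
    *-cancelʳ-≤ _ _ (B ^ j) {{m^n≢0 B j {{>-nonZero 0<B}}}} (begin
      k ^ k * A ^ j * B ^ j          ≡⟨ *-assoc (k ^ k) (A ^ j) (B ^ j) ⟩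
      k ^ k * (A ^ j * B ^ j)        ≡⟨ cong (k ^ k *_) (^-distribʳ-* A B j) ⟨
      k ^ k * (A * B) ^ j            ≤⟨ *-monoʳ-≤ (k ^ k) (^-monoˡ-≤ j AB≤4Pᵏ) ⟩
      k ^ k * (4 * P ^ k) ^ j        ≡⟨ cong (k ^ k *_) (^-distribʳ-* 4 (P ^ k) j) ⟩
      k ^ k * (4 ^ j * (P ^ k) ^ j)  ≡⟨ cong (λ t → k ^ k * (4 ^ j * t)) ^-swap ⟩
      k ^ k * (4 ^ j * (P ^ j) ^ k)  ≡⟨ x*[y*z]≡y*[x*z] (k ^ k) (4 ^ j) ((P ^ j) ^ k) ⟩
      4 ^ j * (k ^ k * (P ^ j) ^ k)  ≡⟨ cong (4 ^ j *_) (^-distribʳ-* k (P ^ j) k) ⟨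
      4 ^ j * (k * P ^ j) ^ k        ≤⟨ *-monoʳ-≤ (4 ^ j) (^-monoˡ-≤ k kPʲ≤NB) ⟩
      4 ^ j * (N * B) ^ k            ≡⟨ cong (4 ^ j *_) (^-distribʳ-* N B k) ⟩
      4 ^ j * (N ^ k * (B * B ^ j))  ≡⟨ regroup (4 ^ j) (N ^ k) B (B ^ j) ⟩
      B * (4 ^ j * N ^ k) * B ^ j    ∎)
    where
    open ≤-Reasoning
    k : ℕ
    k = suc j
    ^-swap : (P ^ k) ^ j ≡ (P ^ j) ^ k
    ^-swap = trans (^-*-assoc P k j) (trans (cong (P ^_) (*-comm k j)) (sym (^-*-assoc P j k)))
    x*[y*z]≡y*[x*z] : ∀ x y z → x * (y * z) ≡ y * (x * z)
    x*[y*z]≡y*[x*z] = solve-∀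
    regroup : ∀ F M B C → F * (M * (B * C)) ≡ B * (F * M) * C
    regroup = solve-∀

  bound-from-either-gap : ∀ j N A B D P Q → 0 < B → 0 < D → D ≤ N * B →
                          A * B ≤ 4 * P ^ suc j → A * B ≤ 4 * Q ^ suc j →
                          (Q ^ suc j + D ≡ P ^ suc j) ⊎ (P ^ suc j + D ≡ Q ^ suc j) →
                          suc j ^ suc j * A ^ j ≤ B * (4 ^ j * N ^ suc j)
  bound-from-either-gap j N A B D P Q 0<B 0<D D≤NB _ AB≤4Qᵏ (inj₁ Qᵏ+D≡Pᵏ) =
    bound-from-gap j N A B Q 0<B (≤-trans (^-gap-lowerBound j {Q = P} Qᵏ+D≡Pᵏ 0<D) D≤NB) AB≤4Qᵏ
  bound-from-either-gap j N A B D P Q 0<B 0<D D≤NB AB≤4Pᵏ _ (inj₂ Pᵏ+D≡Qᵏ) =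
    bound-from-gap j N A B P 0<B (≤-trans (^-gap-lowerBound j {Q = Q} Pᵏ+D≡Qᵏ 0<D) D≤NB) AB≤4Pᵏ

open ℕ-Powers

open import Data.Nat using (ℕ; _<_; _≤_; _∸_)
open import Data.Integer using (ℤ; +_; _+_; _*_; _^_; ∣_∣; 0ℤ) renaming (_≤_ to _≤ℤ_)
open import Relation.Binary.PropositionalEquality using (_≢_)

import Data.Nat as ℕ
import Data.Nat.Properties as ℕ
import Data.Nat.Tactic.RingSolver as ℕ-Solver
open import Data.Integer using (-_; _-_; -[1+_]; +≤+)
open import Data.Integer.Properties using (pos-*; abs-*; +-injective; drop‿+≤+; ∣i∣≡0⇒i≡0; m-n≡m⊖n; ⊖-≥)
open import Data.Integer.Tactic.RingSolver using (solve-∀)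
open import Data.Product using (_,_)
open import Data.Sum using (_⊎_; inj₁; inj₂)
open import Function using (_∘_)
open import Relation.Binary.PropositionalEquality using (_≡_; refl; sym; trans; cong; cong₂; subst; subst₂; module ≡-Reasoning)

pos-^ : ∀ m k → + (m ℕ.^ k) ≡ (+ m) ^ k
pos-^ m ℕ.zero    = refl
pos-^ m (ℕ.suc k) = trans (pos-* m (m ℕ.^ k)) (cong (+ m *_) (pos-^ m k))

+n-+m≡+[n∸m] : ∀ {m n} → m ℕ.≤ n → + n - + m ≡ + (n ∸ m)
+n-+m≡+[n∸m] {m} {n} m≤n = trans (m-n≡m⊖n n m) (⊖-≥ m≤n)

+m+i≡+n⇒m+∣i∣≡n⊎n+∣i∣≡m : ∀ {m n} i → + m + i ≡ + n → (m ℕ.+ ∣ i ∣ ≡ n) ⊎ (n ℕ.+ ∣ i ∣ ≡ m)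
+m+i≡+n⇒m+∣i∣≡n⊎n+∣i∣≡m (+ k) eq = inj₁ (+-injective eq)
+m+i≡+n⇒m+∣i∣≡n⊎n+∣i∣≡m {m} -[1+ k ] eq =
  inj₂ (+-injective (trans (cong (_+ + ℕ.suc k) (sym eq)) (x-y+y≡x (+ m) (+ ℕ.suc k))))
  where
  x-y+y≡x : ∀ x y → x + - y + y ≡ x
  x-y+y≡x = solve-∀

2∣i∣≤m⇒+m+i≡+n⇒m≤2n : ∀ {m n} i → 2 ℕ.* ∣ i ∣ ≤ m → + m + i ≡ + n → m ≤ 2 ℕ.* n
2∣i∣≤m⇒+m+i≡+n⇒m≤2n {m} {n} i 2∣i∣≤m eq with +m+i≡+n⇒m+∣i∣≡n⊎n+∣i∣≡m i eq
... | inj₁ refl    = ℕ.≤-trans (ℕ.m≤m+n m ∣ i ∣) (ℕ.m≤n*m _ 2)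
... | inj₂ n+∣i∣≡m    = m+n≡o⇒2n≤o⇒o≤2m {n} {∣ i ∣} n+∣i∣≡m 2∣i∣≤m

shifted-powers-product-bound : ∀ n a b c d x y k → 2 ℕ.* ∣ n ∣ ≤ a ℕ.* b → 2 ℕ.* ∣ n ∣ ≤ c ℕ.* d →
  + a * + b + n ≡ + (x ℕ.^ k) → + c * + d + n ≡ + (y ℕ.^ k) →
  a ℕ.* b ℕ.* (c ℕ.* d) ≤ 4 ℕ.* (x ℕ.* y) ℕ.^ k
shifted-powers-product-bound n a b c d x y k 2∣n∣≤ab 2∣n∣≤cd ab+n≡xᵏ cd+n≡yᵏ = ℕ.≤-trans
  (ℕ.*-mono-≤ (2∣i∣≤m⇒+m+i≡+n⇒m≤2n n 2∣n∣≤ab (trans (cong (_+ n) (pos-* a b)) ab+n≡xᵏ))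
              (2∣i∣≤m⇒+m+i≡+n⇒m≤2n n 2∣n∣≤cd (trans (cong (_+ n) (pos-* c d)) cd+n≡yᵏ)))
  (ℕ.≤-reflexive (trans (regroup (x ℕ.^ k) (y ℕ.^ k)) (cong (4 ℕ.*_) (sym (^-distribʳ-* x y k)))))
  where
  regroup : ∀ X Y → 2 ℕ.* X ℕ.* (2 ℕ.* Y) ≡ 4 ℕ.* (X ℕ.* Y)
  regroup = ℕ-Solver.solve-∀

cross-product-identity : ∀ n a b c d → a ≤ b → c ≤ d →
  (+ b * + c + n) * (+ a * + d + n) + n * + (b ∸ a) * + (d ∸ c) ≡ (+ a * + c + n) * (+ b * + d + n)
cross-product-identity n a b c d a≤b c≤d = begin
  (+ b * + c + n) * (+ a * + d + n) + n * + (b ∸ a) * + (d ∸ c)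
    ≡⟨ cong₂ (λ e f → (+ b * + c + n) * (+ a * + d + n) + n * e * f) (+n-+m≡+[n∸m] a≤b) (+n-+m≡+[n∸m] c≤d) ⟨
  (+ b * + c + n) * (+ a * + d + n) + n * (+ b - + a) * (+ d - + c)
    ≡⟨ identity n (+ a) (+ b) (+ c) (+ d) ⟩
  (+ a * + c + n) * (+ b * + d + n) ∎
  where
  open ≡-Reasoning
  identity : ∀ n a b c d → (b * c + n) * (a * d + n) + n * (b - a) * (d - c) ≡ (a * c + n) * (b * d + n)
  identity = solve-∀

kthPowers-gap : ∀ k n a b c d x y z w → a ≤ b → c ≤ d →
  + a * + c + n ≡ + (x ℕ.^ k) → + b * + c + n ≡ + (y ℕ.^ k) →
  + a * + d + n ≡ + (z ℕ.^ k) → + b * + d + n ≡ + (w ℕ.^ k) →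
  let D = ∣ n ∣ ℕ.* (b ∸ a) ℕ.* (d ∸ c) in
  ((y ℕ.* z) ℕ.^ k ℕ.+ D ≡ (x ℕ.* w) ℕ.^ k) ⊎ ((x ℕ.* w) ℕ.^ k ℕ.+ D ≡ (y ℕ.* z) ℕ.^ k)
kthPowers-gap k n a b c d x y z w a≤b c≤d ac+n≡xᵏ bc+n≡yᵏ ad+n≡zᵏ bd+n≡wᵏ =
  subst (λ D → ((y ℕ.* z) ℕ.^ k ℕ.+ D ≡ (x ℕ.* w) ℕ.^ k) ⊎ ((x ℕ.* w) ℕ.^ k ℕ.+ D ≡ (y ℕ.* z) ℕ.^ k))
    ∣t∣≡∣n∣ef (+m+i≡+n⇒m+∣i∣≡n⊎n+∣i∣≡m t [yz]ᵏ+t≡[xw]ᵏ)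
  where
  open ≡-Reasoning
  t = n * + (b ∸ a) * + (d ∸ c)
  ∣t∣≡∣n∣ef : ∣ t ∣ ≡ ∣ n ∣ ℕ.* (b ∸ a) ℕ.* (d ∸ c)
  ∣t∣≡∣n∣ef = trans (abs-* (n * + (b ∸ a)) (+ (d ∸ c))) (cong (ℕ._* (d ∸ c)) (abs-* n (+ (b ∸ a))))
  [yz]ᵏ+t≡[xw]ᵏ : + ((y ℕ.* z) ℕ.^ k) + t ≡ + ((x ℕ.* w) ℕ.^ k)
  [yz]ᵏ+t≡[xw]ᵏ = begin
    + ((y ℕ.* z) ℕ.^ k) + t                ≡⟨ cong (λ u → + u + t) (^-distribʳ-* y z k) ⟩
    + (y ℕ.^ k ℕ.* z ℕ.^ k) + t            ≡⟨ cong (_+ t) (pos-* (y ℕ.^ k) (z ℕ.^ k)) ⟩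
    + (y ℕ.^ k) * + (z ℕ.^ k) + t          ≡⟨ cong (_+ t) (cong₂ _*_ bc+n≡yᵏ ad+n≡zᵏ) ⟨
    (+ b * + c + n) * (+ a * + d + n) + t  ≡⟨ cross-product-identity n a b c d a≤b c≤d ⟩
    (+ a * + c + n) * (+ b * + d + n)      ≡⟨ cong₂ _*_ ac+n≡xᵏ bd+n≡wᵏ ⟩
    + (x ℕ.^ k) * + (w ℕ.^ k)              ≡⟨ pos-* (x ℕ.^ k) (w ℕ.^ k) ⟨
    + (x ℕ.^ k ℕ.* w ℕ.^ k)                ≡⟨ cong +_ (^-distribʳ-* x w k) ⟨
    + ((x ℕ.* w) ℕ.^ k)                    ∎

bound-toℤ : ∀ k j N a b c d → k ℕ.^ k ℕ.* (a ℕ.* c) ℕ.^ j ≤ b ℕ.* d ℕ.* (4 ℕ.^ j ℕ.* N ℕ.^ k) →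
            (+ k) ^ k * (+ a * + c) ^ j ≤ℤ (+ b * + d) * ((+ 4) ^ j * (+ N) ^ k)
bound-toℤ k j N a b c d bound = subst₂ _≤ℤ_ lhs rhs (+≤+ bound)
  where
  lhs : + (k ℕ.^ k ℕ.* (a ℕ.* c) ℕ.^ j) ≡ (+ k) ^ k * (+ a * + c) ^ j
  lhs = trans (pos-* (k ℕ.^ k) ((a ℕ.* c) ℕ.^ j)) (cong₂ _*_ (pos-^ k k) (trans (pos-^ (a ℕ.* c) j) (cong (_^ j) (pos-* a c))))
  rhs : + (b ℕ.* d ℕ.* (4 ℕ.^ j ℕ.* N ℕ.^ k)) ≡ (+ b * + d) * ((+ 4) ^ j * (+ N) ^ k)
  rhs = trans (pos-* (b ℕ.* d) (4 ℕ.^ j ℕ.* N ℕ.^ k)) (cong₂ _*_ (pos-* b d) (trans (pos-* (4 ℕ.^ j) (N ℕ.^ k)) (cong₂ _*_ (pos-^ 4 j) (pos-^ N k))))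

lemma3p6 : (k : ℕ) (n : ℤ) (a b c d : ℕ) →
    3 ≤ k → n ≢ 0ℤ →
    0 < a → 0 < b → 0 < c → 0 < d →
    a < b → c < d →
    + 2 * + ∣ n ∣ ≤ℤ + a * + c →
    IsPosKthPower k (+ a * + c + n) →
    IsPosKthPower k (+ b * + c + n) →
    IsPosKthPower k (+ a * + d + n) →
    IsPosKthPower k (+ b * + d + n) →
    (+ k) ^ k * (+ a * + c) ^ (k ∸ 1) ≤ℤ (+ b * + d) * ((+ 4) ^ (k ∸ 1) * (+ ∣ n ∣) ^ k)
lemma3p6 ℕ.zero _ _ _ _ _ ()
lemma3p6 k@(ℕ.suc j) n a b c d _ n≢0 _ 0<b _ 0<d a<b c<d 2∣n∣≤ℤac
         (x , _ , ac+n≡xᵏ) (y , _ , bc+n≡yᵏ) (z , _ , ad+n≡zᵏ) (w , _ , bd+n≡wᵏ) =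
  bound-toℤ k j ∣ n ∣ a b c d
    (bound-from-either-gap j ∣ n ∣ (a ℕ.* c) (b ℕ.* d) D (x ℕ.* w) (y ℕ.* z)
      (ℕ.*-mono-< 0<b 0<d) 0<D D≤∣n∣bd ac*bd≤4[xw]ᵏ ac*bd≤4[yz]ᵏ
      (kthPowers-gap k n a b c d x y z w a≤b c≤d ac+n≡xᵏ bc+n≡yᵏ ad+n≡zᵏ bd+n≡wᵏ))
  where
  a≤b : a ≤ b
  a≤b = ℕ.<⇒≤ a<b
  c≤d : c ≤ d
  c≤d = ℕ.<⇒≤ c<d
  D : ℕ
  D = ∣ n ∣ ℕ.* (b ∸ a) ℕ.* (d ∸ c)
  0<D : 0 < D
  0<D = ℕ.*-mono-< (ℕ.*-mono-< (ℕ.n≢0⇒n>0 (n≢0 ∘ ∣i∣≡0⇒i≡0)) (ℕ.m<n⇒0<n∸m a<b)) (ℕ.m<n⇒0<n∸m c<d)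
  D≤∣n∣bd : D ≤ ∣ n ∣ ℕ.* (b ℕ.* d)
  D≤∣n∣bd = ℕ.≤-trans (ℕ.*-mono-≤ (ℕ.*-monoʳ-≤ ∣ n ∣ (ℕ.m∸n≤m b a)) (ℕ.m∸n≤m d c)) (ℕ.≤-reflexive (ℕ.*-assoc ∣ n ∣ b d))
  2∣n∣≤ : ∀ {p q} → a ≤ p → c ≤ q → 2 ℕ.* ∣ n ∣ ≤ p ℕ.* q
  2∣n∣≤ a≤p c≤q = ℕ.≤-trans (drop‿+≤+ (subst₂ _≤ℤ_ (sym (pos-* 2 ∣ n ∣)) (sym (pos-* a c)) 2∣n∣≤ℤac)) (ℕ.*-mono-≤ a≤p c≤q)
  ac*bd≤4[xw]ᵏ : a ℕ.* c ℕ.* (b ℕ.* d) ≤ 4 ℕ.* (x ℕ.* w) ℕ.^ k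
  ac*bd≤4[xw]ᵏ = shifted-powers-product-bound n a c b d x w k (2∣n∣≤ ℕ.≤-refl ℕ.≤-refl) (2∣n∣≤ a≤b c≤d) ac+n≡xᵏ bd+n≡wᵏ
  ac*bd≤4[yz]ᵏ : a ℕ.* c ℕ.* (b ℕ.* d) ≤ 4 ℕ.* (y ℕ.* z) ℕ.^ k
  ac*bd≤4[yz]ᵏ = subst (ℕ._≤ 4 ℕ.* (y ℕ.* z) ℕ.^ k) (bc*ad≡ac*bd a b c d)
    (shifted-powers-product-bound n b c a d y z k (2∣n∣≤ a≤b ℕ.≤-refl) (2∣n∣≤ ℕ.≤-refl c≤d) bc+n≡yᵏ ad+n≡zᵏ)
    where
    bc*ad≡ac*bd : ∀ a b c d → b ℕ.* c ℕ.* (a ℕ.* d) ≡ a ℕ.* c ℕ.* (b ℕ.* d)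
    bc*ad≡ac*bd = ℕ-Solver.solve-∀
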